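{- Let $L$ be a join-semilattice, $A\subseteq L$, and let $M_1,M_2$ be distinct transversals of $A$. Then $\overline{M_1}\cap M_2\neq\emptyset$.
   Context: For $M\subseteq L$: ${\uparrow}M=\{x:\exists m\in M,\ x\ge m\}$. An element $a$ is connected if $a\le b\vee c$ implies $a\le b$ or $a\le c$; $\mathrm{Cn}\,L$ is the set of connected elements. A connected component of $a$ is a $c\in\mathrm{Cn}\,L$ such that $a=c$ or $a=b\vee c\ne b$ for some $b$; $A_{\mathrm{Cn}}$ is the set of connected components of elements of $A$. For antichains $M,N$: $M\sqsubseteq N$ iff $N\subseteq{\uparrow}M$. A quasitransversal of $A$ is a set $M\subseteq A_{\mathrm{Cn}}$ of pairwise incomparable elements with $A\subseteq{\uparrow}M$; a transversal of $A$ is a quasitransversal $M$ such that there is no quasitransversal $N\ne M$ with $M\sqsubseteq N$. For a quasitransversal $M$, $\overline M=A_{\mathrm{Cn}}\setminus{\uparrow}M$. -}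

module Defs where

open import Level using (Level; _⊔_)
open import Data.Product using (_×_; ∃)
open import Data.Sum using (_⊎_)
open import Relation.Nullary using (¬_)
open import Relation.Unary using (Pred; _∈_; _⊆_)
open import Relation.Binary.Lattice.Bundles using (JoinSemilattice)

module _ {c ℓ₁ ℓ₂ : Level} (L : JoinSemilattice c ℓ₁ ℓ₂) where
  open JoinSemilattice L

  Up : {ℓ : Level} → Pred Carrier ℓ → Pred Carrier (c ⊔ ℓ₂ ⊔ ℓ)
  Up M x = ∃ λ m → m ∈ M × m ≤ x

  IsConnected : Pred Carrier (c ⊔ ℓ₂)
  IsConnected a = ∀ b d → a ≤ b ∨ d → a ≤ b ⊎ a ≤ d

  IsComponentOf : Carrier → Carrier → Set (c ⊔ ℓ₁ ⊔ ℓ₂)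
  IsComponentOf d a =
    IsConnected d × (a ≈ d ⊎ ∃ λ b → (a ≈ b ∨ d) × ¬ (b ∨ d ≈ b))

  ACn : {ℓ : Level} → Pred Carrier ℓ → Pred Carrier (c ⊔ ℓ₁ ⊔ ℓ₂ ⊔ ℓ)
  ACn A d = ∃ λ a → a ∈ A × IsComponentOf d a

  Antichain : {ℓ : Level} → Pred Carrier ℓ → Set (c ⊔ ℓ₁ ⊔ ℓ₂ ⊔ ℓ)
  Antichain M = ∀ x y → x ∈ M → y ∈ M → x ≤ y → x ≈ y

  _⊑_ : {ℓ : Level} → Pred Carrier ℓ → Pred Carrier ℓ → Set (c ⊔ ℓ₂ ⊔ ℓ)
  M ⊑ N = N ⊆ Up M

  SameSet : {ℓ : Level} → Pred Carrier ℓ → Pred Carrier ℓ → Set (c ⊔ ℓ)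
  SameSet M N = M ⊆ N × N ⊆ M

  IsQuasitransversal : {ℓ : Level} → Pred Carrier ℓ → Pred Carrier ℓ → Set (c ⊔ ℓ₁ ⊔ ℓ₂ ⊔ ℓ)
  IsQuasitransversal A M = M ⊆ ACn A × Antichain M × A ⊆ Up M

  IsTransversal : {ℓ : Level} → Pred Carrier ℓ → Pred Carrier ℓ → Set (c ⊔ ℓ₁ ⊔ ℓ₂ ⊔ Level.suc ℓ)
  IsTransversal {ℓ} A M =
    IsQuasitransversal A M ×
    ¬ (∃ λ (N : Pred Carrier ℓ) → IsQuasitransversal A N × ¬ SameSet N M × M ⊑ N)

  Bar : {ℓ : Level} → Pred Carrier ℓ → Pred Carrier ℓ → Pred Carrier (c ⊔ ℓ₁ ⊔ ℓ₂ ⊔ ℓ)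
  Bar A M x = x ∈ ACn A × ¬ (x ∈ Up M)

module Submission where

open import Defs
open import Level using (Level; _⊔_; Lift; lift; lower)
open import Data.Empty using (⊥)
open import Data.Product using (_,_; proj₁; swap)
open import Relation.Nullary using (¬_)
open import Relation.Nullary.Negation using (Stable)
open import Relation.Unary using (Pred; _∈_; _∉_; _⊆_)
open import Relation.Binary.Lattice.Bundles using (JoinSemilattice)
open import Axiom.ExcludedMiddle using (ExcludedMiddle)
open import Axiom.DoubleNegationElimination using (em⇒dne)

-- If M̄₁ ∩ M₂ were empty, every element of M₂ ⊆ A_Cn would lie in ↑M₁, i.e. M₁ ⊑ M₂;
-- maximality of the transversal M₁ then forces M₂ = M₁.

module _ {c ℓ₁ ℓ₂ : Level} (L : JoinSemilattice c ℓ₁ ℓ₂) where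
  open JoinSemilattice L using (Carrier)

  ⊑-if-Bar-disjoint : {ℓ : Level} {A M N : Pred Carrier ℓ} →
    (∀ x → Stable (x ∈ Up L M)) → N ⊆ ACn L A →
    (∀ x → x ∈ Bar L A M → x ∉ N) → _⊑_ L M N
  ⊑-if-Bar-disjoint stable N⊆ACn disjoint {x} x∈N =
    stable x λ x∉↑M → disjoint x (N⊆ACn x∈N , x∉↑M) x∈N

  transversal-⊑-maximal : {ℓ : Level} {A M N : Pred Carrier ℓ} →
    IsTransversal L A M → IsQuasitransversal L A N → ¬ SameSet L N M → ¬ _⊑_ L M N
  transversal-⊑-maximal {N = N} (_ , maximal) qN N≢M M⊑N = maximal (N , qN , N≢M , M⊑N)

lemma2p8p1 : {c ℓ₁ ℓ₂ ℓ : Level} → ExcludedMiddle (c ⊔ ℓ₁ ⊔ ℓ₂ ⊔ ℓ) →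
    (L : JoinSemilattice c ℓ₁ ℓ₂) →
    (A M₁ M₂ : Pred (JoinSemilattice.Carrier L) ℓ) →
    IsTransversal L A M₁ → IsTransversal L A M₂ → ¬ SameSet L M₁ M₂ →
    ¬ (∀ x → x ∈ Bar L A M₁ → x ∈ M₂ → ⊥)
lemma2p8p1 {c} {ℓ₁} {ℓ₂} {ℓ} em L A M₁ M₂ t₁ (q₂ , _) M₁≢M₂ disjoint =
  transversal-⊑-maximal L t₁ q₂ (λ M₂≡M₁ → M₁≢M₂ (swap M₂≡M₁)) M₁⊑M₂
  where
  ↑M₁-stable : ∀ x → Stable (x ∈ Up L M₁)
  ↑M₁-stable x ¬¬x∈↑M₁ =
    lower (em⇒dne em {Lift (c ⊔ ℓ₁ ⊔ ℓ₂ ⊔ ℓ) _} λ ¬x∈↑M₁ → ¬¬x∈↑M₁ λ p → ¬x∈↑M₁ (lift p))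

  M₁⊑M₂ : _⊑_ L M₁ M₂
  M₁⊑M₂ = ⊑-if-Bar-disjoint L ↑M₁-stable (proj₁ q₂) disjoint
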